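{- Let $\mathcal{M}=(X,\vec{\mathcal{C}},\mathcal{V})$ be a quasi-discrete closure model. The relation $\simeq$ on $X$ given by $x_1\simeq x_2$ iff $x_1,x_2$ satisfy exactly the same ${\tt IMLC}$ formulas in $\mathcal{M}$ is a CMC-bisimulation for $\mathcal{M}$.
   Context: Fix a set $\mathtt{AP}$ of atomic propositions. For a relation $R\subseteq X\times X$ let $\mathcal{C}_R(A)=A\cup\{x\in X:\exists a\in A,\ (a,x)\in R\}$. A quasi-discrete closure model is $\mathcal{M}=(X,\vec{\mathcal{C}},\mathcal{V})$ with $\vec{\mathcal{C}}=\mathcal{C}_R$ for a relation $R\subseteq X\times X$ and $\mathcal{V}:\mathtt{AP}\to\mathcal{P}(X)$; put $\overleftarrow{\mathcal{C}}=\mathcal{C}_{R^{ -1}}$ and write $\vec{\mathcal{C}}(x)$ for $\vec{\mathcal{C}}(\{x\})$, similarly for $\overleftarrow{\mathcal{C}}$. A symmetric relation $B\subseteq X\times X$ is a CMC-bisimulation if whenever $(x_1,x_2)\in B$: (1) for all $p\in\mathtt{AP}$, $x_1\in\mathcal{V}(p)$ iff $x_2\in\mathcal{V}(p)$; (2) for all $x_1'\in\vec{\mathcal{C}}(x_1)$ there is $x_2'\in\vec{\mathcal{C}}(x_2)$ with $(x_1',x_2')\in B$; (3) for all $x_1'\in\overleftarrow{\mathcal{C}}(x_1)$ there is $x_2'\in\overleftarrow{\mathcal{C}}(x_2)$ with $(x_1',x_2')\in B$. ${\tt IMLC}$ formulas: $\Phi::=p\mid\neg\Phi\mid\bigwedge_{i\in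 I}\Phi_i\mid\vec{\mathcal{N}}\Phi\mid\overleftarrow{\mathcal{N}}\Phi$ ($I$ arbitrary index set), with $x\models p$ iff $x\in\mathcal{V}(p)$, usual Boolean clauses, $x\models\vec{\mathcal{N}}\Phi$ iff $x\in\vec{\mathcal{C}}(\{y:y\models\Phi\})$, $x\models\overleftarrow{\mathcal{N}}\Phi$ iff $x\in\overleftarrow{\mathcal{C}}(\{y:y\models\Phi\})$. -}

module Defs where

open import Level using (Level; _⊔_) renaming (zero to lzero; suc to lsuc)
open import Data.Product using (Σ; ∃; _×_; _,_)
open import Data.Sum using (_⊎_)
open import Relation.Nullary using (¬_)
open import Relation.Binary.PropositionalEquality using (_≡_)
open import Function.Bundles using (_⇔_)

𝒞 : {X : Set} → (X → X → Set) → {ℓ : Level} → (X → Set ℓ) → X → Set ℓ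
𝒞 {X} R A x = A x ⊎ Σ X (λ a → A a × R a x)

_⁻¹ : {X : Set} → (X → X → Set) → X → X → Set
(R ⁻¹) x y = R y x

⟦_⟧ : {X : Set} → X → X → Set
⟦ x ⟧ y = x ≡ y

record QDCM (AP : Set) : Set₁ where
  field
    X : Set
    R : X → X → Set
    V : AP → X → Set

  C→ : {ℓ : Level} → (X → Set ℓ) → X → Set ℓ
  C→ = 𝒞 R

  C← : {ℓ : Level} → (X → Set ℓ) → X → Set ℓ
  C← = 𝒞 (R ⁻¹)

data Formula (AP : Set) : Set₁ where
  atom : AP → Formula AP
  ¬ᶠ_  : Formula AP → Formula AP
  ⋀    : (I : Set) → (I → Formula AP) → Formula AP
  N→   : Formula AP → Formula AP
  N←   : Formula AP → Formula AP

module _ {AP : Set} (M : QDCM AP) where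
  open QDCM M

  _⊨_ : X → Formula AP → Set
  x ⊨ atom p   = V p x
  x ⊨ (¬ᶠ Φ)   = ¬ (x ⊨ Φ)
  x ⊨ ⋀ I Φs   = (i : I) → x ⊨ Φs i
  x ⊨ N→ Φ     = C→ (λ y → y ⊨ Φ) x
  x ⊨ N← Φ     = C← (λ y → y ⊨ Φ) x

  _≃_ : X → X → Set₁
  x₁ ≃ x₂ = (Φ : Formula AP) → (x₁ ⊨ Φ) ⇔ (x₂ ⊨ Φ)

  record IsCMCBisimulation {ℓ : Level} (B : X → X → Set ℓ) : Set (lsuc lzero ⊔ ℓ) where
    field
      symmetric : ∀ {x₁ x₂} → B x₁ x₂ → B x₂ x₁
      atoms     : ∀ {x₁ x₂} → B x₁ x₂ → (p : AP) → V p x₁ ⇔ V p x₂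
      forth→    : ∀ {x₁ x₂} → B x₁ x₂ → (x₁' : X) → C→ ⟦ x₁ ⟧ x₁' →
                  Σ X (λ x₂' → C→ ⟦ x₂ ⟧ x₂' × B x₁' x₂')
      forth←    : ∀ {x₁ x₂} → B x₁ x₂ → (x₁' : X) → C← ⟦ x₁ ⟧ x₁' →
                  Σ X (λ x₂' → C← ⟦ x₂ ⟧ x₂' × B x₁' x₂')

-- Two IMLC-equivalent points x₁ ≃ x₂ are bisimilar: given x₁' in the forward
-- closure of x₁, classically pick for each candidate y in the forward closure
-- of x₂ a formula true at x₁' and false at y (or ⊤ if x₁' ≃ y), and let χ be
-- their infinitary conjunction. Then x₁ ⊨ N← χ, hence x₂ ⊨ N← χ, so some
-- candidate y satisfies χ, which forces x₁' ≃ y. The backward clause is the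
-- same argument with R replaced by its converse and N← by N→.
module Submission where

open import Defs
open import Level using (Level; lift; lower) renaming (suc to lsuc; zero to lzero)
open import Axiom.ExcludedMiddle using (ExcludedMiddle)
open import Axiom.DoubleNegationElimination using (em⇒dne)
open import Data.Product using (Σ; ∃; _×_; _,_; proj₁; proj₂)
open import Data.Sum using (inj₁; inj₂)
open import Data.Empty using (⊥; ⊥-elim)
open import Function using (_∘_; const)
open import Relation.Nullary using (¬_; yes; no)
open import Relation.Binary.PropositionalEquality using (refl)
open import Function.Bundles using (_⇔_; mk⇔; Equivalence)
open import Function.Construct.Symmetry using (⇔-sym)

𝒞⁻¹⇔meets-𝒞⟦⟧ : {X : Set} (S : X → X → Set) {ℓ : Level} (A : X → Set ℓ) (x : X) →
                𝒞 (S ⁻¹) A x ⇔ ∃ λ x' → 𝒞 S ⟦ x ⟧ x' × A x'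
𝒞⁻¹⇔meets-𝒞⟦⟧ S A x = mk⇔ to from
  where
  to : 𝒞 (S ⁻¹) A x → ∃ λ x' → 𝒞 S ⟦ x ⟧ x' × A x'
  to (inj₁ Ax)               = x  , inj₁ refl , Ax
  to (inj₂ (x' , Ax' , Sxx')) = x' , inj₂ (x , refl , Sxx') , Ax'

  from : (∃ λ x' → 𝒞 S ⟦ x ⟧ x' × A x') → 𝒞 (S ⁻¹) A x
  from (x' , inj₁ refl , Ax')              = inj₁ Ax'
  from (x' , inj₂ (x , refl , Sxx') , Ax') = inj₂ (x' , Ax' , Sxx')

module _ {AP : Set} (M : QDCM AP) where
  open QDCM M

  private
    _⊨'_ : X → Formula AP → Set
    _⊨'_ = _⊨_ M

    _≃'_ : X → X → Set₁
    _≃'_ = _≃_ M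

  ⊤ᶠ : Formula AP
  ⊤ᶠ = ⋀ ⊥ ⊥-elim

  ≃-sym : ∀ {x₁ x₂} → x₁ ≃' x₂ → x₂ ≃' x₁
  ≃-sym x₁≃x₂ = ⇔-sym ∘ x₁≃x₂

  module Classical (em : ExcludedMiddle (lsuc lzero)) where

    ¬¬-elim : {P : Set} → ¬ ¬ P → P
    ¬¬-elim ¬¬p = lower (em⇒dne em λ ¬p → ¬¬p (¬p ∘ lift))

    separating : (a y : X) → Σ (Formula AP) λ Φ → a ⊨' Φ × (y ⊨' Φ → a ≃' y)
    separating a y with em {∃ λ Φ → a ⊨' Φ × ¬ (y ⊨' Φ)}
    ... | yes (Φ , a⊨Φ , y⊭Φ) = Φ , a⊨Φ , ⊥-elim ∘ y⊭Φ
    ... | no none = ⊤ᶠ , (λ ()) , const λ Φ → mk⇔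
          (λ a⊨Φ → ¬¬-elim λ y⊭Φ → none (Φ , a⊨Φ , y⊭Φ))
          (λ y⊨Φ → ¬¬-elim λ a⊭Φ → none (¬ᶠ Φ , a⊭Φ , λ y⊭Φ → y⊭Φ y⊨Φ))

    characteristic : (a : X) (Y : X → Set) →
                     Σ (Formula AP) λ χ → a ⊨' χ × (∀ {y} → Y y → y ⊨' χ → a ≃' y)
    characteristic a Y = ⋀ (∃ Y) (Φ ∘ proj₁) , (λ (y , _) → a⊨Φ y) ,
                         λ {y} Yy y⊨χ → y⊨Φ⇒a≃y y (y⊨χ (y , Yy))
      where
      Φ : X → Formula AP
      Φ y = proj₁ (separating a y)
      a⊨Φ : ∀ y → a ⊨' Φ y
      a⊨Φ y = proj₁ (proj₂ (separating a y))
      y⊨Φ⇒a≃y : ∀ y → y ⊨' Φ y → a ≃' y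
      y⊨Φ⇒a≃y y = proj₂ (proj₂ (separating a y))

    ≃-forth : (S : X → X → Set) (N : Formula AP → Formula AP) →
              (∀ Φ x → x ⊨' N Φ ⇔ ∃ λ x' → 𝒞 S ⟦ x ⟧ x' × x' ⊨' Φ) →
              ∀ {x₁ x₂} → x₁ ≃' x₂ → (x₁' : X) → 𝒞 S ⟦ x₁ ⟧ x₁' →
              Σ X λ x₂' → 𝒞 S ⟦ x₂ ⟧ x₂' × x₁' ≃' x₂'
    ≃-forth S N N-meets {x₁} {x₂} x₁≃x₂ x₁' x₁→x₁'
      with characteristic x₁' (𝒞 S ⟦ x₂ ⟧)
    ... | χ , x₁'⊨χ , χ-pins
      with Equivalence.to (N-meets χ x₂)
             (Equivalence.to (x₁≃x₂ (N χ))
               (Equivalence.from (N-meets χ x₁) (x₁' , x₁→x₁' , x₁'⊨χ)))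
    ... | x₂' , x₂→x₂' , x₂'⊨χ = x₂' , x₂→x₂' , χ-pins x₂→x₂' x₂'⊨χ

lemma4p12 : ExcludedMiddle (lsuc lzero) → {AP : Set} → (M : QDCM AP) →
            IsCMCBisimulation M (_≃_ M)
lemma4p12 em M = record
  { symmetric = ≃-sym M
  ; atoms     = λ x₁≃x₂ p → x₁≃x₂ (atom p)
  ; forth→    = ≃-forth R       N← λ Φ → 𝒞⁻¹⇔meets-𝒞⟦⟧ R       (λ y → _⊨_ M y Φ)
  ; forth←    = ≃-forth (R ⁻¹) N→ λ Φ → 𝒞⁻¹⇔meets-𝒞⟦⟧ (R ⁻¹) (λ y → _⊨_ M y Φ)
  }
  where
  open QDCM M
  open Classical M em
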